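{- For two Maker-Breaker poset positional games $\mathcal{G}_1,\mathcal{G}_2$ of given parities and given outcomes, the set of outcomes that the disjoint union $\mathcal{G}_1\cup\mathcal{G}_2$ can have (i.e. the outcomes realized by some such pair, and only these) is as follows, writing "$o_1,o_2$: list" for $o(\mathcal{G}_1)=o_1$, $o(\mathcal{G}_2)=o_2$ (the relation is symmetric in the two games). Both even: $\mathcal{M},\mathcal{M}$: $\mathcal{M}$; $\mathcal{M},\mathcal{N}$: $\mathcal{M}$; $\mathcal{M},\mathcal{P}$: $\mathcal{M}$; $\mathcal{M},\mathcal{B}$: $\mathcal{M}$; $\mathcal{N},\mathcal{N}$: $\mathcal{M},\mathcal{N}$; $\mathcal{N},\mathcal{P}$: $\mathcal{M}$; $\mathcal{N},\mathcal{B}$: $\mathcal{M},\mathcal{N}$; $\mathcal{P},\mathcal{P}$: $\mathcal{P}$; $\mathcal{P},\mathcal{B}$: $\mathcal{P}$; $\mathcal{B},\mathcal{B}$: $\mathcal{P},\mathcal{B}$. $\mathcal{G}_1$ even, $\mathcal{G}_2$ odd: $\mathcal{M},\mathcal{M}$: $\mathcal{M}$; $\mathcal{M},\mathcal{N}$: $\mathcal{M},\mathcal{N}$; $\mathcal{M},\mathcal{P}$: $\mathcal{M}$; $\mathcal{M},\mathcal{B}$: $\mathcal{M},\mathcal{N}$; $\mathcal{N},\mathcal{M}$: $\mathcal{M}$; $\mathcal{N},\mathcal{N}$: $\mathcal{M},\mathcal{N}$; $\mathcal{N},\mathcal{P}$: $\mathcal{M}$; $\mathcal{N},\mathcal{B}$: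 all four outcomes; $\mathcal{P},\mathcal{M}$: $\mathcal{M}$; $\mathcal{P},\mathcal{N}$: $\mathcal{N}$; $\mathcal{P},\mathcal{P}$: $\mathcal{M}$; $\mathcal{P},\mathcal{B}$: $\mathcal{N}$; $\mathcal{B},\mathcal{M}$: $\mathcal{M}$; $\mathcal{B},\mathcal{N}$: $\mathcal{N}$; $\mathcal{B},\mathcal{P}$: $\mathcal{M},\mathcal{P}$; $\mathcal{B},\mathcal{B}$: $\mathcal{N},\mathcal{B}$. Both odd: $\mathcal{M},\mathcal{M}$: $\mathcal{M}$; $\mathcal{M},\mathcal{N}$: $\mathcal{M}$; $\mathcal{M},\mathcal{P}$: $\mathcal{M}$; $\mathcal{M},\mathcal{B}$: $\mathcal{M},\mathcal{N}$; $\mathcal{N},\mathcal{N}$: $\mathcal{M},\mathcal{P}$; $\mathcal{N},\mathcal{P}$: $\mathcal{M},\mathcal{N}$; $\mathcal{N},\mathcal{B}$: all four outcomes; $\mathcal{P},\mathcal{P}$: $\mathcal{M}$; $\mathcal{P},\mathcal{B}$: $\mathcal{M},\mathcal{N}$; $\mathcal{B},\mathcal{B}$: all four outcomes.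
   Context: A poset positional game is a triple $(X,\mathcal{F},P)$ with $X$ a finite board of vertices, $\mathcal{F}\subseteq 2^X$ the winning sets, and $P$ a partial order on $X$. Two players alternately claim an unclaimed vertex $v$ such that all vertices smaller than $v$ in $P$ are already claimed, until all vertices are claimed. In the Maker-Breaker convention, Maker wins if she claims all vertices of some winning set; otherwise Breaker wins. Either player may start. The outcome $o(\mathcal{G})$ is $\mathcal{M}$ if Maker has a winning strategy whoever starts, $\mathcal{B}$ if Breaker has a winning strategy whoever starts, $\mathcal{N}$ if the first player has a winning strategy, and $\mathcal{P}$ if the second player has a winning strategy. A game is even (resp. odd) if its board has an even (resp. odd) number of vertices. The disjoint union of games on disjoint boards has as board the union of boards, as winning sets the union of the families, and as poset the union of the posets with elements of different games incomparable. -}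

module Defs where

open import Level using (0ℓ)
open import Data.Nat using (ℕ; _+_; _%_)
open import Data.Fin using (Fin; splitAt; _↑ˡ_; _↑ʳ_; _≟_)
open import Data.List using (List; map; _++_; [_]; [])
open import Data.List.Relation.Unary.Any using (Any)
open import Data.List.Relation.Unary.All using (All)
open import Data.Sum using (_⊎_; inj₁; inj₂)
open import Data.Product using (_×_; Σ)
open import Data.Empty using (⊥)
open import Relation.Nullary using (¬_; does)
open import Relation.Binary using (Rel; IsStrictPartialOrder)
open import Relation.Binary.PropositionalEquality using (_≡_)
open import Data.Bool using (if_then_else_)

record Game : Set₁ where
  field
    size : ℕ
    wins : List (List (Fin size))
    _≺_  : Rel (Fin size) 0ℓ

open Game public

IsPosetGame : Game → Set
IsPosetGame G = IsStrictPartialOrder _≡_ (_≺_ G)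

data Cell : Set where
  free makerC breakerC : Cell

data Player : Set where
  maker breaker : Player

module Play (G : Game) where
  open Game G using () renaming (size to N; wins to winsG; _≺_ to _<P_)

  State : Set
  State = Fin N → Cell

  start : State
  start _ = free

  Legal : State → Fin N → Set
  Legal s v = (s v ≡ free) × (∀ u → u <P v → ¬ (s u ≡ free))

  claim : State → Fin N → Cell → State
  claim s v c u = if does (u ≟ v) then c else s u

  Full : State → Set
  Full s = ∀ v → ¬ (s v ≡ free)

  MakerClaimed : State → Set
  MakerClaimed s = Any (λ W → All (λ v → s v ≡ makerC) W) winsG

  -- MakerWins s p : Maker has a winning strategy from position s with p to move
  data MakerWins : State → Player → Set where
    endM   : ∀ {s p} → Full s → MakerClaimed s → MakerWins s p
    makerM : ∀ {s} v → Legal s v → MakerWins (claim s v makerC) breaker →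
             MakerWins s maker
    breakM : ∀ {s} → ¬ Full s →
             (∀ v → Legal s v → MakerWins (claim s v breakerC) maker) →
             MakerWins s breaker

  data BreakerWins : State → Player → Set where
    endB   : ∀ {s p} → Full s → ¬ MakerClaimed s → BreakerWins s p
    breakB : ∀ {s} v → Legal s v → BreakerWins (claim s v breakerC) maker →
             BreakerWins s breaker
    makerB : ∀ {s} → ¬ Full s →
             (∀ v → Legal s v → BreakerWins (claim s v makerC) breaker) →
             BreakerWins s maker

data Outcome : Set where
  𝓜 𝓝 𝓟 𝓑 : Outcome

HasOutcome : Game → Outcome → Set
HasOutcome G 𝓜 = MakerWins start maker × MakerWins start breaker
  where open Play G
HasOutcome G 𝓑 = BreakerWins start maker × BreakerWins start breaker
  where open Play G
HasOutcome G 𝓝 = MakerWins start maker × BreakerWins start breaker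
  where open Play G
HasOutcome G 𝓟 = MakerWins start breaker × BreakerWins start maker
  where open Play G

data Parity : Set where
  even odd : Parity

HasParity : Parity → ℕ → Set
HasParity even n = n % 2 ≡ 0
HasParity odd  n = n % 2 ≡ 1

union≺ : ∀ {n₁ n₂} → Rel (Fin n₁) 0ℓ → Rel (Fin n₂) 0ℓ →
         Fin (n₁ + n₂) → Fin (n₁ + n₂) → Set
union≺ {n₁} r₁ r₂ x y with splitAt n₁ x | splitAt n₁ y
... | inj₁ a | inj₁ b = r₁ a b
... | inj₂ a | inj₂ b = r₂ a b
... | inj₁ _ | inj₂ _ = ⊥
... | inj₂ _ | inj₁ _ = ⊥

_∪G_ : Game → Game → Game
G₁ ∪G G₂ = record
  { size = size G₁ + size G₂
  ; wins = map (map (_↑ˡ size G₂)) (wins G₁) ++ map (map (size G₁ ↑ʳ_)) (wins G₂)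
  ; _≺_  = union≺ (_≺_ G₁) (_≺_ G₂)
  }

all4 : List Outcome
all4 = 𝓜 Data.List.∷ 𝓝 Data.List.∷ 𝓟 Data.List.∷ 𝓑 Data.List.∷ []

two : Outcome → Outcome → List Outcome
two a b = a Data.List.∷ b Data.List.∷ []

tableEO : Outcome → Outcome → List Outcome
tableEO 𝓜 𝓜 = [ 𝓜 ]
tableEO 𝓜 𝓝 = two 𝓜 𝓝
tableEO 𝓜 𝓟 = [ 𝓜 ]
tableEO 𝓜 𝓑 = two 𝓜 𝓝
tableEO 𝓝 𝓜 = [ 𝓜 ]
tableEO 𝓝 𝓝 = two 𝓜 𝓝
tableEO 𝓝 𝓟 = [ 𝓜 ]
tableEO 𝓝 𝓑 = all4
tableEO 𝓟 𝓜 = [ 𝓜 ]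
tableEO 𝓟 𝓝 = [ 𝓝 ]
tableEO 𝓟 𝓟 = [ 𝓜 ]
tableEO 𝓟 𝓑 = [ 𝓝 ]
tableEO 𝓑 𝓜 = [ 𝓜 ]
tableEO 𝓑 𝓝 = [ 𝓝 ]
tableEO 𝓑 𝓟 = two 𝓜 𝓟
tableEO 𝓑 𝓑 = two 𝓝 𝓑

table : Parity → Parity → Outcome → Outcome → List Outcome
table even even 𝓜 _ = [ 𝓜 ]
table even even _ 𝓜 = [ 𝓜 ]
table even even 𝓝 𝓝 = two 𝓜 𝓝
table even even 𝓝 𝓟 = [ 𝓜 ]
table even even 𝓟 𝓝 = [ 𝓜 ]
table even even 𝓝 𝓑 = two 𝓜 𝓝
table even even 𝓑 𝓝 = two 𝓜 𝓝
table even even 𝓟 𝓟 = [ 𝓟 ]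
table even even 𝓟 𝓑 = [ 𝓟 ]
table even even 𝓑 𝓟 = [ 𝓟 ]
table even even 𝓑 𝓑 = two 𝓟 𝓑
table even odd o₁ o₂ = tableEO o₁ o₂
table odd even o₁ o₂ = tableEO o₂ o₁
table odd odd 𝓜 𝓜 = [ 𝓜 ]
table odd odd 𝓜 𝓝 = [ 𝓜 ]
table odd odd 𝓝 𝓜 = [ 𝓜 ]
table odd odd 𝓜 𝓟 = [ 𝓜 ]
table odd odd 𝓟 𝓜 = [ 𝓜 ]
table odd odd 𝓜 𝓑 = two 𝓜 𝓝
table odd odd 𝓑 𝓜 = two 𝓜 𝓝
table odd odd 𝓝 𝓝 = two 𝓜 𝓟
table odd odd 𝓝 𝓟 = two 𝓜 𝓝
table odd odd 𝓟 𝓝 = two 𝓜 𝓝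
table odd odd 𝓝 𝓑 = all4
table odd odd 𝓑 𝓝 = all4
table odd odd 𝓟 𝓟 = [ 𝓜 ]
table odd odd 𝓟 𝓑 = two 𝓜 𝓝
table odd odd 𝓑 𝓟 = two 𝓜 𝓝
table odd odd 𝓑 𝓑 = all4

{-# OPTIONS --safe #-}
module Submission where

-- Strategies for the two components combine into strategies for the union.  Maker wins the
-- union as second player if she wins both components as second player: she answers every
-- Breaker move in the component where it was made.  A component with an even number of free
-- vertices can instead be neutralised by answering there arbitrarily, since an odd number of
-- free vertices always leaves a reply.  Breaker can answer componentwise only if both
-- components are even, so that no Maker move fills a component.  Who has to open in which
-- component is then decided by the parities, and each outcome missing from the table
-- contradicts one of these combinations.  Conversely, finite games are determined, so the
-- outcomes of small explicit games can be computed, and every entry of the table is realised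
-- by a pair of such games.

open import Defs
open import Data.Product using (_×_; Σ; ∃; _,_; proj₁; uncurry)
open import Data.List.Membership.Propositional using (_∈_)

open import Level using (0ℓ)
open import Function using (_∘_; id; case_of_)
open import Data.Bool using (if_then_else_)
open import Data.Empty using (⊥; ⊥-elim)
open import Data.Nat using (ℕ; zero; suc; _+_; _%_) renaming (_≟_ to _≟ⁿ_)
open import Data.Nat.Properties using (+-suc; +-comm; m+n≡0⇒n≡0; suc-injective)
open import Data.Nat.DivMod using ([m+n]%n≡m%n)
open import Data.Fin using (Fin; zero; suc; splitAt; _↑ˡ_; _↑ʳ_; #_) renaming (_≟_ to _≟ᶠ_)
import Data.Fin.Properties as Fin
open import Data.Fin.Properties using (splitAt-↑ˡ; splitAt-↑ʳ; all?)
open import Data.Fin.Induction using (spo-wellFounded)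
open import Data.List using (List; []; _∷_)
open import Data.List.Relation.Unary.All as All using (All)
import Data.List.Relation.Unary.All.Properties as AllP
open import Data.List.Relation.Unary.Any as Any using (Any; here; there)
import Data.List.Relation.Unary.Any.Properties as AnyP
import Data.List.Membership.DecPropositional as DecMembership
open import Data.List.Relation.Binary.Pointwise using (Pointwise; []; _∷_)
import Data.List.Relation.Binary.Pointwise.Properties as Pointwise
import Data.Product.Properties as ×
open import Data.Sum using (_⊎_; inj₁; inj₂)
import Data.Sum as Sum
open import Induction.WellFounded using (Acc; acc)
open import Relation.Binary using (Rel; Decidable; DecidableEquality)
open import Relation.Nullary
  using (¬_; ¬?; Dec; yes; no; does; map′; _×-dec_; _⊎-dec_; _→-dec_)
open import Relation.Nullary.Decidable using (toWitness; toSum)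
open import Relation.Binary.PropositionalEquality
  using (_≡_; _≢_; _≗_; refl; sym; trans; cong; cong₂; subst; resp₂; isEquivalence)

flip : Parity → Parity
flip even = odd
flip odd = even

flip-involutive : ∀ p → flip (flip p) ≡ p
flip-involutive even = refl
flip-involutive odd = refl

parity : ℕ → Parity
parity zero = even
parity (suc n) = flip (parity n)

hasParity⇒parity : ∀ {p} n → HasParity p n → parity n ≡ p
hasParity⇒parity {even} zero _ = refl
hasParity⇒parity {odd} zero ()
hasParity⇒parity {even} (suc zero) ()
hasParity⇒parity {odd} (suc zero) _ = refl
hasParity⇒parity {p} (suc (suc n)) h =
  trans (flip-involutive (parity n)) (hasParity⇒parity n (hasParity-pred p h))
  where
  %2-pred : suc (suc n) % 2 ≡ n % 2
  %2-pred = trans (cong (_% 2) (+-comm 2 n)) ([m+n]%n≡m%n n 2)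
  hasParity-pred : ∀ p → HasParity p (suc (suc n)) → HasParity p n
  hasParity-pred even h = trans (sym %2-pred) h
  hasParity-pred odd h = trans (sym %2-pred) h

freeIndicator : Cell → ℕ
freeIndicator free = 1
freeIndicator makerC = 0
freeIndicator breakerC = 0

freeIndicator-taken : ∀ {c} → c ≢ free → freeIndicator c ≡ 0
freeIndicator-taken {free} c≢free = ⊥-elim (c≢free refl)
freeIndicator-taken {makerC} _ = refl
freeIndicator-taken {breakerC} _ = refl

freeCount : ∀ {n} → (Fin n → Cell) → ℕ
freeCount {zero} _ = 0
freeCount {suc n} s = freeIndicator (s zero) + freeCount (s ∘ suc)

freeCount-cong : ∀ {n} {s t : Fin n → Cell} → s ≗ t → freeCount s ≡ freeCount t
freeCount-cong {zero} _ = refl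
freeCount-cong {suc n} s≗t = cong₂ _+_ (cong freeIndicator (s≗t zero)) (freeCount-cong (s≗t ∘ suc))

freeCount-fill : ∀ {n} (s t : Fin n → Cell) v → s v ≡ free → t v ≢ free →
                 (∀ u → u ≢ v → s u ≡ t u) → freeCount s ≡ suc (freeCount t)
freeCount-fill {suc n} s t zero sv tv same =
  trans (cong₂ _+_ (cong freeIndicator sv) (freeCount-cong (λ u → same (suc u) λ ())))
        (cong (λ k → suc (k + freeCount (t ∘ suc))) (sym (freeIndicator-taken tv)))
freeCount-fill {suc n} s t (suc v) sv tv same =
  trans (cong₂ _+_ (cong freeIndicator (same zero λ ()))
                   (freeCount-fill (s ∘ suc) (t ∘ suc) v sv tv
                     (λ u u≢v → same (suc u) (u≢v ∘ Fin.suc-injective))))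
        (+-suc (freeIndicator (t zero)) (freeCount (t ∘ suc)))

freeCount≡0⇒full : ∀ {n} (s : Fin n → Cell) → freeCount s ≡ 0 → ∀ v → s v ≢ free
freeCount≡0⇒full {suc n} s count zero sv with s zero
freeCount≡0⇒full {suc n} s () zero refl | free
freeCount≡0⇒full {suc n} s count (suc v) =
  freeCount≡0⇒full (s ∘ suc) (m+n≡0⇒n≡0 (freeIndicator (s zero)) count) v

full⇒freeCount≡0 : ∀ {n} (s : Fin n → Cell) → (∀ v → s v ≢ free) → freeCount s ≡ 0
full⇒freeCount≡0 {zero} s full = refl
full⇒freeCount≡0 {suc n} s full =
  cong₂ _+_ (freeIndicator-taken (full zero)) (full⇒freeCount≡0 (s ∘ suc) (full ∘ suc))

freeCount-allFree : ∀ n → freeCount {n} (λ _ → free) ≡ n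
freeCount-allFree zero = refl
freeCount-allFree (suc n) = cong suc (freeCount-allFree n)

≗-trans : ∀ {n} {s t r : Fin n → Cell} → s ≗ t → t ≗ r → s ≗ r
≗-trans s≗t t≗r u = trans (s≗t u) (t≗r u)

module Positions (G : Game) where
  open Play G public

  claim-≡ : ∀ s v c → claim s v c v ≡ c
  claim-≡ s v c with v ≟ᶠ v
  ... | yes _ = refl
  ... | no v≢v = ⊥-elim (v≢v refl)

  claim-≢ : ∀ s {v u} c → u ≢ v → claim s v c u ≡ s u
  claim-≢ s {v} {u} c u≢v with u ≟ᶠ v
  ... | yes u≡v = ⊥-elim (u≢v u≡v)
  ... | no _ = refl

  claim-cong : ∀ {s t} v c → s ≗ t → claim s v c ≗ claim t v c
  claim-cong v c s≗t u = cong (λ x → if does (u ≟ᶠ v) then c else x) (s≗t u)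

  freeCount-claim : ∀ s {v} c → s v ≡ free → c ≢ free →
                    freeCount s ≡ suc (freeCount (claim s v c))
  freeCount-claim s {v} c sv c≢free =
    freeCount-fill s (claim s v c) v sv (c≢free ∘ trans (sym (claim-≡ s v c)))
      (λ u u≢v → sym (claim-≢ s c u≢v))

  parity-claim : ∀ s {v} c → s v ≡ free → c ≢ free →
                 parity (freeCount (claim s v c)) ≡ flip (parity (freeCount s))
  parity-claim s c sv c≢free =
    trans (sym (flip-involutive _)) (cong (flip ∘ parity) (sym (freeCount-claim s c sv c≢free)))

  parity-cong : ∀ {s t : State} → s ≗ t → parity (freeCount s) ≡ parity (freeCount t)
  parity-cong s≗t = cong parity (freeCount-cong s≗t)

  odd⇒¬full : ∀ {s : State} → parity (freeCount s) ≡ odd → ¬ Full s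
  odd⇒¬full {s} odd-s full with trans (sym (cong parity (full⇒freeCount≡0 s full))) odd-s
  ... | ()

  legal-cong : ∀ {s t v} → s ≗ t → Legal s v → Legal t v
  legal-cong {v = v} s≗t (sv , below) =
    trans (sym (s≗t v)) sv , λ u u<v tu → below u u<v (trans (s≗t u) tu)

  full-cong : ∀ {s t} → s ≗ t → Full s → Full t
  full-cong s≗t full v tv = full v (trans (s≗t v) tv)

  claimed-cong : ∀ {s t} → s ≗ t → MakerClaimed s → MakerClaimed t
  claimed-cong s≗t = Any.map (All.map λ {v} sv → trans (sym (s≗t v)) sv)

  makerWins-cong : ∀ {s t p} → s ≗ t → MakerWins s p → MakerWins t p
  makerWins-cong s≗t (endM full cl) = endM (full-cong s≗t full) (claimed-cong s≗t cl)
  makerWins-cong s≗t (makerM v l mw) =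
    makerM v (legal-cong s≗t l) (makerWins-cong (claim-cong v makerC s≗t) mw)
  makerWins-cong s≗t (breakM ¬full mws) =
    breakM (¬full ∘ full-cong (sym ∘ s≗t))
      (λ v l → makerWins-cong (claim-cong v breakerC s≗t) (mws v (legal-cong (sym ∘ s≗t) l)))

  breakerWins-cong : ∀ {s t p} → s ≗ t → BreakerWins s p → BreakerWins t p
  breakerWins-cong s≗t (endB full ¬cl) = endB (full-cong s≗t full) (¬cl ∘ claimed-cong (sym ∘ s≗t))
  breakerWins-cong s≗t (breakB v l bw) =
    breakB v (legal-cong s≗t l) (breakerWins-cong (claim-cong v breakerC s≗t) bw)
  breakerWins-cong s≗t (makerB ¬full bws) =
    makerB (¬full ∘ full-cong (sym ∘ s≗t))
      (λ v l → breakerWins-cong (claim-cong v makerC s≗t) (bws v (legal-cong (sym ∘ s≗t) l)))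

  makerWins-full⇒claimed : ∀ {s p} → Full s → MakerWins s p → MakerClaimed s
  makerWins-full⇒claimed full (endM _ cl) = cl
  makerWins-full⇒claimed full (makerM v (sv , _) _) = ⊥-elim (full v sv)
  makerWins-full⇒claimed full (breakM ¬full _) = ⊥-elim (¬full full)

  claimed-claim : ∀ {s v c} → MakerClaimed s → s v ≡ free → MakerClaimed (claim s v c)
  claimed-claim {s} {v} {c} cl sv = Any.map (All.map keep) cl
    where
    keep : ∀ {u} → s u ≡ makerC → claim s v c u ≡ makerC
    keep su = trans (claim-≢ s c λ { refl → case trans (sym su) sv of λ () }) su

  HasLegalMoves : Set
  HasLegalMoves = ∀ {s} → ¬ Full s → ¬ ¬ ∃ (Legal s)

  -- Strict partial orders on Fin n are well-founded, and a ≺-minimal free vertex is legal.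
  poset⇒hasLegalMoves : IsPosetGame G → HasLegalMoves
  poset⇒hasLegalMoves poset {s} ¬full noMove = ¬full λ v → minimal (spo-wellFounded poset v)
    where
    minimal : ∀ {v} → Acc (_≺_ G) v → s v ≢ free
    minimal (acc below) sv = noMove (_ , sv , λ u u<v → minimal (below u<v))

  breakerWins⇒¬claimed : HasLegalMoves → ∀ {s p} → BreakerWins s p → ¬ MakerClaimed s
  breakerWins⇒¬claimed moves (endB _ ¬cl) cl = ¬cl cl
  breakerWins⇒¬claimed moves (breakB v (sv , _) bw) cl =
    breakerWins⇒¬claimed moves bw (claimed-claim cl sv)
  breakerWins⇒¬claimed moves (makerB ¬full bws) cl =
    moves ¬full λ (v , l) → breakerWins⇒¬claimed moves (bws v l) (claimed-claim cl (proj₁ l))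

-- U is the disjoint union of A and B, up to the relabelling of vertices by inA and inB.
record Splitting (U A B : Game) : Set where
  field
    inA : Fin (size A) → Fin (size U)
    inB : Fin (size B) → Fin (size U)
    inA-injective : ∀ {x x′} → inA x ≡ inA x′ → x ≡ x′
    inB-injective : ∀ {y y′} → inB y ≡ inB y′ → y ≡ y′
    inA≢inB : ∀ x y → inA x ≢ inB y
    cover : ∀ z → (∃ λ x → inA x ≡ z) ⊎ (∃ λ y → inB y ≡ z)
    ≺-inA⁻ : ∀ {x x′} → _≺_ U (inA x) (inA x′) → _≺_ A x x′
    ≺-inA⁺ : ∀ {x x′} → _≺_ A x x′ → _≺_ U (inA x) (inA x′)
    ≺-inB⁻ : ∀ {y y′} → _≺_ U (inB y) (inB y′) → _≺_ B y y′
    ≺-inB⁺ : ∀ {y y′} → _≺_ B y y′ → _≺_ U (inB y) (inB y′)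
    inB⊀inA : ∀ {x y} → ¬ _≺_ U (inB y) (inA x)
    inA⊀inB : ∀ {x y} → ¬ _≺_ U (inA x) (inB y)
    claimed-inA : ∀ (s : Play.State U) → Play.MakerClaimed A (s ∘ inA) → Play.MakerClaimed U s
    claimed-inB : ∀ (s : Play.State U) → Play.MakerClaimed B (s ∘ inB) → Play.MakerClaimed U s
    claimed-split : ∀ (s : Play.State U) → Play.MakerClaimed U s →
                    Play.MakerClaimed A (s ∘ inA) ⊎ Play.MakerClaimed B (s ∘ inB)
    isPosetA : IsPosetGame A
    isPosetB : IsPosetGame B

swap : ∀ {U A B} → Splitting U A B → Splitting U B A
swap S = record
  { inA = inB ; inB = inA
  ; inA-injective = inB-injective ; inB-injective = inA-injective
  ; inA≢inB = λ y x → inA≢inB x y ∘ sym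
  ; cover = Sum.swap ∘ cover
  ; ≺-inA⁻ = ≺-inB⁻ ; ≺-inA⁺ = ≺-inB⁺ ; ≺-inB⁻ = ≺-inA⁻ ; ≺-inB⁺ = ≺-inA⁺
  ; inB⊀inA = inA⊀inB ; inA⊀inB = inB⊀inA
  ; claimed-inA = claimed-inB ; claimed-inB = claimed-inA
  ; claimed-split = λ s → Sum.swap ∘ claimed-split s
  ; isPosetA = isPosetB ; isPosetB = isPosetA
  }
  where open Splitting S

module MovesInA {U A B : Game} (S : Splitting U A B) where
  open Splitting S
  private
    module U = Positions U
    module A = Positions A
    module B = Positions B

  legal-inA : ∀ {s x} → A.Legal (s ∘ inA) x → U.Legal s (inA x)
  legal-inA {s} {x} (sx , below) = sx , taken-below
    where
    taken-below : ∀ z → _≺_ U z (inA x) → s z ≢ free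
    taken-below z z<x with cover z
    ... | inj₁ (x′ , refl) = below x′ (≺-inA⁻ z<x)
    ... | inj₂ (y , refl) = ⊥-elim (inB⊀inA z<x)

  legal-inA⁻ : ∀ {s x} → U.Legal s (inA x) → A.Legal (s ∘ inA) x
  legal-inA⁻ (sx , below) = sx , λ x′ x′<x → below (inA x′) (≺-inA⁺ x′<x)

  claim-inA↾A : ∀ s x c → A.claim (s ∘ inA) x c ≗ U.claim s (inA x) c ∘ inA
  claim-inA↾A s x c x′ with x′ ≟ᶠ x
  ... | yes refl = sym (U.claim-≡ s (inA x′) c)
  ... | no x′≢x = sym (U.claim-≢ s c (x′≢x ∘ inA-injective))

  claim-inA↾B : ∀ s x c → s ∘ inB ≗ U.claim s (inA x) c ∘ inB
  claim-inA↾B s x c y = sym (U.claim-≢ s c (inA≢inB x y ∘ sym))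

  parity-claim-inA↾A : ∀ s {x} c → s (inA x) ≡ free → c ≢ free →
    parity (freeCount (U.claim s (inA x) c ∘ inA)) ≡ flip (parity (freeCount (s ∘ inA)))
  parity-claim-inA↾A s {x} c sx c≢free =
    trans (sym (A.parity-cong (claim-inA↾A s x c))) (A.parity-claim (s ∘ inA) c sx c≢free)

  parity-claim-inA↾B : ∀ s x c →
    parity (freeCount (U.claim s (inA x) c ∘ inB)) ≡ parity (freeCount (s ∘ inB))
  parity-claim-inA↾B s x c = sym (B.parity-cong (claim-inA↾B s x c))

module Split {U A B : Game} (S : Splitting U A B) where
  open Splitting S public
  open MovesInA S public
  open MovesInA (swap S) public using () renaming
    ( legal-inA to legal-inB ; legal-inA⁻ to legal-inB⁻
    ; claim-inA↾A to claim-inB↾B ; claim-inA↾B to claim-inB↾A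
    ; parity-claim-inA↾A to parity-claim-inB↾B ; parity-claim-inA↾B to parity-claim-inB↾A )
  private
    module U = Positions U
    module A = Positions A
    module B = Positions B

  full-join : ∀ {s} → A.Full (s ∘ inA) → B.Full (s ∘ inB) → U.Full s
  full-join fullA fullB z with cover z
  ... | inj₁ (x , refl) = fullA x
  ... | inj₂ (y , refl) = fullB y

  hasLegalMoves : U.HasLegalMoves
  hasLegalMoves {s} ¬full noMove = ¬full (full-join fullA fullB)
    where
    fullA : A.Full (s ∘ inA)
    fullA x sx = A.poset⇒hasLegalMoves isPosetA (λ full → full x sx)
                   λ (x′ , l) → noMove (inA x′ , legal-inA l)
    fullB : B.Full (s ∘ inB)
    fullB y sy = B.poset⇒hasLegalMoves isPosetB (λ full → full y sy)
                   λ (y′ , l) → noMove (inB y′ , legal-inB l)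

module _ {n₁ n₂ : ℕ} (r₁ : Rel (Fin n₁) 0ℓ) (r₂ : Rel (Fin n₂) 0ℓ) where

  union≺-↑ˡ : ∀ x x′ → union≺ r₁ r₂ (x ↑ˡ n₂) (x′ ↑ˡ n₂) ≡ r₁ x x′
  union≺-↑ˡ x x′ rewrite splitAt-↑ˡ n₁ x n₂ | splitAt-↑ˡ n₁ x′ n₂ = refl

  union≺-↑ʳ : ∀ y y′ → union≺ r₁ r₂ (n₁ ↑ʳ y) (n₁ ↑ʳ y′) ≡ r₂ y y′
  union≺-↑ʳ y y′ rewrite splitAt-↑ʳ n₁ n₂ y | splitAt-↑ʳ n₁ n₂ y′ = refl

  union≺-↑ˡ↑ʳ : ∀ x y → union≺ r₁ r₂ (x ↑ˡ n₂) (n₁ ↑ʳ y) ≡ ⊥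
  union≺-↑ˡ↑ʳ x y rewrite splitAt-↑ˡ n₁ x n₂ | splitAt-↑ʳ n₁ n₂ y = refl

  union≺-↑ʳ↑ˡ : ∀ x y → union≺ r₁ r₂ (n₁ ↑ʳ y) (x ↑ˡ n₂) ≡ ⊥
  union≺-↑ʳ↑ˡ x y rewrite splitAt-↑ˡ n₁ x n₂ | splitAt-↑ʳ n₁ n₂ y = refl

∪-splitting : ∀ {G₁ G₂} → IsPosetGame G₁ → IsPosetGame G₂ → Splitting (G₁ ∪G G₂) G₁ G₂
∪-splitting {G₁} {G₂} poset₁ poset₂ = record
  { inA = _↑ˡ n₂
  ; inB = n₁ ↑ʳ_
  ; inA-injective = Fin.↑ˡ-injective n₂ _ _
  ; inB-injective = Fin.↑ʳ-injective n₁ _ _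
  ; inA≢inB = λ x y e → inj₁≢inj₂ (trans (sym (splitAt-↑ˡ n₁ x n₂))
                                   (trans (cong (splitAt n₁) e) (splitAt-↑ʳ n₁ n₂ y)))
  ; cover = cover
  ; ≺-inA⁻ = λ {x} {x′} → subst id (union≺-↑ˡ r₁ r₂ x x′)
  ; ≺-inA⁺ = λ {x} {x′} → subst id (sym (union≺-↑ˡ r₁ r₂ x x′))
  ; ≺-inB⁻ = λ {y} {y′} → subst id (union≺-↑ʳ r₁ r₂ y y′)
  ; ≺-inB⁺ = λ {y} {y′} → subst id (sym (union≺-↑ʳ r₁ r₂ y y′))
  ; inB⊀inA = λ {x} {y} → subst id (union≺-↑ʳ↑ˡ r₁ r₂ x y)
  ; inA⊀inB = λ {x} {y} → subst id (union≺-↑ˡ↑ʳ r₁ r₂ x y)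
  ; claimed-inA = λ _ → AnyP.++⁺ˡ ∘ AnyP.map⁺ ∘ Any.map AllP.map⁺
  ; claimed-inB = λ _ → AnyP.++⁺ʳ _ ∘ AnyP.map⁺ ∘ Any.map AllP.map⁺
  ; claimed-split = λ _ → Sum.map (Any.map AllP.map⁻ ∘ AnyP.map⁻) (Any.map AllP.map⁻ ∘ AnyP.map⁻)
                          ∘ AnyP.++⁻ _
  ; isPosetA = poset₁
  ; isPosetB = poset₂
  }
  where
  n₁ n₂ : ℕ
  n₁ = size G₁
  n₂ = size G₂
  r₁ : Rel (Fin n₁) 0ℓ
  r₁ = _≺_ G₁
  r₂ : Rel (Fin n₂) 0ℓ
  r₂ = _≺_ G₂
  inj₁≢inj₂ : ∀ {x : Fin n₁} {y : Fin n₂} → inj₁ x ≢ inj₂ y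
  inj₁≢inj₂ ()
  cover : ∀ z → (∃ λ x → x ↑ˡ n₂ ≡ z) ⊎ (∃ λ y → n₁ ↑ʳ y ≡ z)
  cover z with splitAt n₁ z in eq
  ... | inj₁ x = inj₁ (x , Fin.splitAt⁻¹-↑ˡ eq)
  ... | inj₂ y = inj₂ (y , Fin.splitAt⁻¹-↑ʳ eq)

-- Combining strategies

-- Maker follows her strategy for A on Breaker's moves in A.  In B she follows her strategy
-- for B, or, when an even number of B-vertices is free, answers a Breaker move in B by any
-- legal B-move.
module MakerAnswers {U A B : Game} (S : Splitting U A B) where
  open Split S
  private
    module U = Positions U
    module A = Positions A
    module B = Positions B
  open U using (endB; breakB; makerB)
  open A using (endM; makerM; breakM)
  open B using (endM; makerM; breakM)

  Answerable : B.State → Set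
  Answerable t = B.MakerWins t breaker ⊎ parity (freeCount t) ≡ even

  Owed : B.State → Set
  Owed t = B.MakerWins t maker ⊎ parity (freeCount t) ≡ odd

  answerable-cong : ∀ {t t′} → t ≗ t′ → Answerable t → Answerable t′
  answerable-cong t≗t′ = Sum.map (B.makerWins-cong t≗t′) (trans (sym (B.parity-cong t≗t′)))

  owed-cong : ∀ {t t′} → t ≗ t′ → Owed t → Owed t′
  owed-cong t≗t′ = Sum.map (B.makerWins-cong t≗t′) (trans (sym (B.parity-cong t≗t′)))

  answerable⇒owed : ∀ {t y} → Answerable t → B.Legal t y →
                    B.MakerClaimed t ⊎ Owed (B.claim t y breakerC)
  answerable⇒owed (inj₁ (endM _ cl)) _ = inj₁ cl
  answerable⇒owed (inj₁ (breakM _ mbs)) l = inj₂ (inj₁ (mbs _ l))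
  answerable⇒owed {t} (inj₂ even-t) (ty , _) =
    inj₂ (inj₂ (trans (B.parity-claim t breakerC ty λ ()) (cong flip even-t)))

  private
    ¬breakerWins-claimedA : ∀ {s p} → A.MakerClaimed (s ∘ inA) → ¬ U.BreakerWins s p
    ¬breakerWins-claimedA cl bw = U.breakerWins⇒¬claimed hasLegalMoves bw (claimed-inA _ cl)

    ¬breakerWins-claimedB : ∀ {s p} → B.MakerClaimed (s ∘ inB) → ¬ U.BreakerWins s p
    ¬breakerWins-claimedB cl bw = U.breakerWins⇒¬claimed hasLegalMoves bw (claimed-inB _ cl)

  mutual
    answer : ∀ {s} → A.MakerWins (s ∘ inA) breaker → Answerable (s ∘ inB) →
             ¬ U.BreakerWins s breaker
    answer (endM _ cl) _ bw = ¬breakerWins-claimedA cl bw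
    answer (breakM ¬fullA _) _ (endB full _) = ¬fullA (full ∘ inA)
    answer {s} ma@(breakM _ mas) ans bw@(breakB z l bw′) with cover z
    ... | inj₁ (x , refl) =
      moveInA (A.makerWins-cong (claim-inA↾A s x breakerC) (mas x (legal-inA⁻ l)))
              (answerable-cong (claim-inA↾B s x breakerC) ans) bw′
    ... | inj₂ (y , refl) with answerable⇒owed ans (legal-inB⁻ l)
    ...   | inj₁ cl = ¬breakerWins-claimedB cl bw
    ...   | inj₂ owed = moveInB (A.makerWins-cong (claim-inB↾A s y breakerC) ma)
                                (owed-cong (claim-inB↾B s y breakerC) owed) bw′

    moveInA : ∀ {s} → A.MakerWins (s ∘ inA) maker → Answerable (s ∘ inB) →
              ¬ U.BreakerWins s maker
    moveInA (endM _ cl) _ bw = ¬breakerWins-claimedA cl bw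
    moveInA (makerM x (sx , _) _) _ (endB full _) = full (inA x) sx
    moveInA {s} (makerM x l ma) ans (makerB _ bws) =
      answer (A.makerWins-cong (claim-inA↾A s x makerC) ma)
             (answerable-cong (claim-inA↾B s x makerC) ans) (bws (inA x) (legal-inA l))

    moveInB : ∀ {s} → A.MakerWins (s ∘ inA) breaker → Owed (s ∘ inB) →
              ¬ U.BreakerWins s maker
    moveInB ma (inj₁ (endM _ cl)) bw = ¬breakerWins-claimedB cl bw
    moveInB ma (inj₁ (makerM y l mb)) bw = moveInB-at y l (inj₁ mb) ma bw
    moveInB {s} ma (inj₂ odd-s) bw =
      B.poset⇒hasLegalMoves isPosetB (B.odd⇒¬full odd-s) λ (y , l) →
        moveInB-at y l (inj₂ (trans (B.parity-claim (s ∘ inB) makerC (proj₁ l) λ ()) (cong flip odd-s)))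
                   ma bw

    moveInB-at : ∀ {s} y → B.Legal (s ∘ inB) y → Answerable (B.claim (s ∘ inB) y makerC) →
                 A.MakerWins (s ∘ inA) breaker → ¬ U.BreakerWins s maker
    moveInB-at y (sy , _) _ _ (endB full _) = full (inB y) sy
    moveInB-at {s} y l ans ma (makerB _ bws) =
      answer (A.makerWins-cong (claim-inB↾A s y makerC) ma)
             (answerable-cong (claim-inB↾B s y makerC) ans) (bws (inB y) (legal-inB l))

open Splitting using (inA; inB)

-- When both components have an even number of free vertices, Breaker answers each Maker move
-- by his strategy in the same component; it has a reply because an odd number of vertices remain.
mutual
  breakerAnswers : ∀ {U A B} (S : Splitting U A B) {s} →
    Play.BreakerWins A (s ∘ inA S) maker → Play.BreakerWins B (s ∘ inB S) maker →
    parity (freeCount (s ∘ inA S)) ≡ even → parity (freeCount (s ∘ inB S)) ≡ even →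
    ¬ Play.MakerWins U s maker
  breakerAnswers {U} {A} {B} S ba bb _ _ (Play.endM _ cl) with Splitting.claimed-split S _ cl
  ... | inj₁ clA = Positions.breakerWins⇒¬claimed A
                     (Positions.poset⇒hasLegalMoves A (Splitting.isPosetA S)) ba clA
  ... | inj₂ clB = Positions.breakerWins⇒¬claimed B
                     (Positions.poset⇒hasLegalMoves B (Splitting.isPosetB S)) bb clB
  breakerAnswers S ba bb evenA evenB (Play.makerM z l mw) with Splitting.cover S z
  ... | inj₁ (x , refl) = breakerAnswersInA S ba bb evenA evenB l mw
  ... | inj₂ (y , refl) = breakerAnswersInA (swap S) bb ba evenB evenA l mw

  breakerAnswersInA : ∀ {U A B} (S : Splitting U A B) {s x} →
    Play.BreakerWins A (s ∘ inA S) maker → Play.BreakerWins B (s ∘ inB S) maker →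
    parity (freeCount (s ∘ inA S)) ≡ even → parity (freeCount (s ∘ inB S)) ≡ even →
    Play.Legal U s (inA S x) → ¬ Play.MakerWins U (Play.claim U s (inA S x) makerC) breaker
  breakerAnswersInA S (Play.endB fullA _) _ _ _ (sx , _) _ = fullA _ sx
  breakerAnswersInA {U} {A} {B} S {s} {x} (Play.makerB _ bas) bb evenA evenB l =
    reply (bas x (legal-inA⁻ l))
    where
    open Split S hiding (inA; inB)
    module U = Positions U
    module A = Positions A
    module B = Positions B
    s′ : U.State
    s′ = U.claim s (inA S x) makerC
    oddA′ : parity (freeCount (s′ ∘ inA S)) ≡ odd
    oddA′ = trans (parity-claim-inA↾A s makerC (proj₁ l) λ ()) (cong flip evenA)
    reply : A.BreakerWins (A.claim (s ∘ inA S) x makerC) breaker → ¬ U.MakerWins s′ breaker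
    reply (A.endB fullA′ _) _ = A.odd⇒¬full oddA′ (A.full-cong (claim-inA↾A s x makerC) fullA′)
    reply (A.breakB _ _ _) (U.endM full _) = A.odd⇒¬full oddA′ (full ∘ inA S)
    reply (A.breakB w lw ba′) (U.breakM _ mws) =
      breakerAnswers S
        (A.breakerWins-cong (≗-trans (A.claim-cong w breakerC (claim-inA↾A s x makerC))
                                      (claim-inA↾A s′ w breakerC)) ba′)
        (B.breakerWins-cong (≗-trans (claim-inA↾B s x makerC) (claim-inA↾B s′ w breakerC)) bb)
        (trans (parity-claim-inA↾A s′ breakerC (proj₁ lw′) λ ()) (cong flip oddA′))
        (trans (parity-claim-inA↾B s′ w breakerC) (trans (parity-claim-inA↾B s x makerC) evenB))
        (mws (inA S w) (legal-inA lw′))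
      where
      lw′ : A.Legal (s′ ∘ inA S) w
      lw′ = A.legal-cong (claim-inA↾A s x makerC) lw

breakerOpensInB : ∀ {U A B} (S : Splitting U A B) {s} →
  Play.BreakerWins A (s ∘ inA S) maker → parity (freeCount (s ∘ inA S)) ≡ even →
  Play.BreakerWins B (s ∘ inB S) breaker → parity (freeCount (s ∘ inB S)) ≡ odd →
  ¬ Play.MakerWins U s breaker
breakerOpensInB {B = B} S _ _ (Play.endB fullB _) oddB _ = Positions.odd⇒¬full B oddB fullB
breakerOpensInB {B = B} S _ _ (Play.breakB _ _ _) oddB (Play.endM full _) =
  Positions.odd⇒¬full B oddB (full ∘ inB S)
breakerOpensInB {U} {A} {B} S {s} ba evenA (Play.breakB y l bb) oddB (Play.breakM _ mws) =
  breakerAnswers S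
    (Positions.breakerWins-cong A (claim-inB↾A s y breakerC) ba)
    (Positions.breakerWins-cong B (claim-inB↾B s y breakerC) bb)
    (trans (parity-claim-inB↾A s y breakerC) evenA)
    (trans (parity-claim-inB↾B s breakerC (proj₁ l) λ ()) (cong flip oddB))
    (mws (inB S y) (legal-inB l))
  where open Split S hiding (inA; inB)

-- Breaker's opening move makes its component even, and Maker then opens in the other one.
makerAnswersAcross : ∀ {U A B} (S : Splitting U A B) {s} →
  Play.MakerWins A (s ∘ inA S) maker → parity (freeCount (s ∘ inA S)) ≡ odd →
  Play.MakerWins B (s ∘ inB S) maker → parity (freeCount (s ∘ inB S)) ≡ odd →
  ¬ Play.BreakerWins U s breaker
makerAnswersAcross {A = A} S _ oddA _ _ (Play.endB full _) =
  Positions.odd⇒¬full A oddA (full ∘ inA S)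
makerAnswersAcross {U} {A} {B} S {s} ma oddA mb oddB (Play.breakB z l bw)
  with Splitting.cover S z
... | inj₁ (x , refl) =
  MakerAnswers.moveInA (swap S) (Positions.makerWins-cong B (claim-inA↾B s x breakerC) mb)
    (inj₂ (trans (parity-claim-inA↾A s breakerC (proj₁ l) λ ()) (cong flip oddA))) bw
  where open Split S hiding (inA; inB)
... | inj₂ (y , refl) =
  MakerAnswers.moveInA S (Positions.makerWins-cong A (claim-inB↾A s y breakerC) ma)
    (inj₂ (trans (parity-claim-inB↾B s breakerC (proj₁ l) λ ()) (cong flip oddB))) bw
  where open Split S hiding (inA; inB)

-- Outcomes excluded by the table

opponent : Player → Player
opponent maker = breaker
opponent breaker = maker

winner : Outcome → Player → Player
winner 𝓜 _ = maker
winner 𝓝 p = p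
winner 𝓟 p = opponent p
winner 𝓑 _ = breaker

Wins : Game → Player → Player → Set
Wins G maker p = Play.MakerWins G (Play.start G) p
Wins G breaker p = Play.BreakerWins G (Play.start G) p

hasOutcome⇒wins : ∀ {G o} → HasOutcome G o → ∀ p → Wins G (winner o p) p
hasOutcome⇒wins {o = 𝓜} (m , _) maker = m
hasOutcome⇒wins {o = 𝓜} (_ , m) breaker = m
hasOutcome⇒wins {o = 𝓝} (m , _) maker = m
hasOutcome⇒wins {o = 𝓝} (_ , b) breaker = b
hasOutcome⇒wins {o = 𝓟} (_ , b) maker = b
hasOutcome⇒wins {o = 𝓟} (m , _) breaker = m
hasOutcome⇒wins {o = 𝓑} (b , _) maker = b
hasOutcome⇒wins {o = 𝓑} (_ , b) breaker = b

winnerWins : ∀ {G o p w} → HasOutcome G o → winner o p ≡ w → Wins G w p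
winnerWins {p = p} h refl = hasOutcome⇒wins h p

outcome : Player → Player → Outcome
outcome maker maker = 𝓜
outcome maker breaker = 𝓝
outcome breaker maker = 𝓟
outcome breaker breaker = 𝓑

outcome-winner : ∀ o → outcome (winner o maker) (winner o breaker) ≡ o
outcome-winner 𝓜 = refl
outcome-winner 𝓝 = refl
outcome-winner 𝓟 = refl
outcome-winner 𝓑 = refl

wins⇒hasOutcome : ∀ {G} w₁ w₂ → Wins G w₁ maker → Wins G w₂ breaker →
                  HasOutcome G (outcome w₁ w₂)
wins⇒hasOutcome maker maker m m′ = m , m′
wins⇒hasOutcome maker breaker m b = m , b
wins⇒hasOutcome breaker maker b m = m , b
wins⇒hasOutcome breaker breaker b b′ = b , b′

_≟ᴾ_ : DecidableEquality Player
maker ≟ᴾ maker = yes refl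
maker ≟ᴾ breaker = no λ ()
breaker ≟ᴾ maker = no λ ()
breaker ≟ᴾ breaker = yes refl

_≟ᵖ_ : DecidableEquality Parity
even ≟ᵖ even = yes refl
even ≟ᵖ odd = no λ ()
odd ≟ᵖ even = no λ ()
odd ≟ᵖ odd = yes refl

_≟ᴼ_ : DecidableEquality Outcome
o ≟ᴼ o′ = map′ winners-injective (cong winners) (×.≡-dec _≟ᴾ_ _≟ᴾ_ (winners o) (winners o′))
  where
  winners : Outcome → Player × Player
  winners o = winner o maker , winner o breaker
  winners-injective : winners o ≡ winners o′ → o ≡ o′
  winners-injective e =
    trans (sym (outcome-winner o)) (trans (cong (uncurry outcome) e) (outcome-winner o′))

startParity : ∀ G {p q} → HasParity p (size G) → p ≡ q → parity (freeCount (Play.start G)) ≡ q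
startParity G h refl = trans (cong parity (freeCount-allFree (size G))) (hasParity⇒parity _ h)

AnswerableProfile : Parity × Outcome → Set
AnswerableProfile (p , o) = winner o breaker ≡ maker ⊎ p ≡ even

answerableProfile? : ∀ c → Dec (AnswerableProfile c)
answerableProfile? (p , o) = winner o breaker ≟ᴾ maker ⊎-dec p ≟ᵖ even

OwedProfile : Parity × Outcome → Set
OwedProfile (p , o) = winner o maker ≡ maker ⊎ p ≡ odd

owedProfile? : ∀ c → Dec (OwedProfile c)
owedProfile? (p , o) = winner o maker ≟ᴾ maker ⊎-dec p ≟ᵖ odd

-- Forbids (pA , oA) (pB , oB) p w: a lemma of the previous section refutes every winning
-- strategy of w, when p starts, in a union of games with parities pA, pB and outcomes oA, oB.
Forbids : Parity × Outcome → Parity × Outcome → Player → Player → Set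
Forbids (pA , oA) (pB , oB) breaker breaker =
  winner oA breaker ≡ maker × AnswerableProfile (pB , oB)
  ⊎ (winner oA maker ≡ maker × pA ≡ odd) × (winner oB maker ≡ maker × pB ≡ odd)
Forbids (pA , oA) (pB , oB) maker breaker =
  winner oA maker ≡ maker × AnswerableProfile (pB , oB)
  ⊎ winner oA breaker ≡ maker × OwedProfile (pB , oB)
Forbids (pA , oA) (pB , oB) maker maker =
  (winner oA maker ≡ breaker × pA ≡ even) × (winner oB maker ≡ breaker × pB ≡ even)
Forbids (pA , oA) (pB , oB) breaker maker =
  (winner oA maker ≡ breaker × pA ≡ even) × (winner oB breaker ≡ breaker × pB ≡ odd)

forbids? : ∀ cA cB p w → Dec (Forbids cA cB p w)
forbids? (pA , oA) (pB , oB) breaker breaker =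
  winner oA breaker ≟ᴾ maker ×-dec answerableProfile? (pB , oB)
  ⊎-dec (winner oA maker ≟ᴾ maker ×-dec pA ≟ᵖ odd) ×-dec (winner oB maker ≟ᴾ maker ×-dec pB ≟ᵖ odd)
forbids? (pA , oA) (pB , oB) maker breaker =
  winner oA maker ≟ᴾ maker ×-dec answerableProfile? (pB , oB)
  ⊎-dec winner oA breaker ≟ᴾ maker ×-dec owedProfile? (pB , oB)
forbids? (pA , oA) (pB , oB) maker maker =
  (winner oA maker ≟ᴾ breaker ×-dec pA ≟ᵖ even) ×-dec (winner oB maker ≟ᴾ breaker ×-dec pB ≟ᵖ even)
forbids? (pA , oA) (pB , oB) breaker maker =
  (winner oA maker ≟ᴾ breaker ×-dec pA ≟ᵖ even) ×-dec (winner oB breaker ≟ᴾ breaker ×-dec pB ≟ᵖ odd)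

module _ {U A B : Game} (S : Splitting U A B) {pA pB : Parity} {oA oB : Outcome}
         (hpA : HasParity pA (size A)) (hoA : HasOutcome A oA)
         (hpB : HasParity pB (size B)) (hoB : HasOutcome B oB) where

  forbids-sound : ∀ p w → Forbids (pA , oA) (pB , oB) p w → ¬ Wins U w p
  forbids-sound breaker breaker (inj₁ (mA , ans)) =
    MakerAnswers.answer S (winnerWins hoA mA) (Sum.map (winnerWins hoB) (startParity B hpB) ans)
  forbids-sound breaker breaker (inj₂ ((mA , oddA) , (mB , oddB))) =
    makerAnswersAcross S (winnerWins hoA mA) (startParity A hpA oddA)
                         (winnerWins hoB mB) (startParity B hpB oddB)
  forbids-sound maker breaker (inj₁ (mA , ans)) =
    MakerAnswers.moveInA S (winnerWins hoA mA) (Sum.map (winnerWins hoB) (startParity B hpB) ans)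
  forbids-sound maker breaker (inj₂ (mA , owed)) =
    MakerAnswers.moveInB S (winnerWins hoA mA) (Sum.map (winnerWins hoB) (startParity B hpB) owed)
  forbids-sound maker maker ((bA , evenA) , (bB , evenB)) =
    breakerAnswers S (winnerWins hoA bA) (winnerWins hoB bB)
                     (startParity A hpA evenA) (startParity B hpB evenB)
  forbids-sound breaker maker ((bA , evenA) , (bB , oddB)) =
    breakerOpensInB S (winnerWins hoA bA) (startParity A hpA evenA)
                      (winnerWins hoB bB) (startParity B hpB oddB)
Forbidden : Parity × Outcome → Parity × Outcome → Player → Player → Set
Forbidden c₁ c₂ p w = Forbids c₁ c₂ p w ⊎ Forbids c₂ c₁ p w

forbidden-sound : ∀ {U A B} (S : Splitting U A B) {pA pB oA oB} →
                  HasParity pA (size A) → HasOutcome A oA → HasParity pB (size B) → HasOutcome B oB →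
                  ∀ p w → Forbidden (pA , oA) (pB , oB) p w → ¬ Wins U w p
forbidden-sound S hpA hoA hpB hoB p w (inj₁ f) = forbids-sound S hpA hoA hpB hoB p w f
forbidden-sound S hpA hoA hpB hoB p w (inj₂ f) = forbids-sound (swap S) hpB hoB hpA hoA p w f

Refuted : Parity → Parity → Outcome → Outcome → Outcome → Set
Refuted p₁ p₂ o₁ o₂ o = Forbidden (p₁ , o₁) (p₂ , o₂) maker (winner o maker)
                      ⊎ Forbidden (p₁ , o₁) (p₂ , o₂) breaker (winner o breaker)

refuted? : ∀ p₁ p₂ o₁ o₂ o → Dec (Refuted p₁ p₂ o₁ o₂ o)
refuted? p₁ p₂ o₁ o₂ o = forbidden? maker (winner o maker) ⊎-dec forbidden? breaker (winner o breaker)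
  where
  forbidden? : ∀ p w → Dec (Forbidden (p₁ , o₁) (p₂ , o₂) p w)
  forbidden? p w = forbids? (p₁ , o₁) (p₂ , o₂) p w ⊎-dec forbids? (p₂ , o₂) (p₁ , o₁) p w

∀-parity? : {P : Parity → Set} → (∀ p → Dec (P p)) → Dec (∀ p → P p)
∀-parity? P? = map′ (λ { (e , _) even → e ; (_ , o) odd → o }) (λ f → f even , f odd)
                    (P? even ×-dec P? odd)

∀-outcome? : {P : Outcome → Set} → (∀ o → Dec (P o)) → Dec (∀ o → P o)
∀-outcome? P? =
  map′ (λ { (m , _) 𝓜 → m ; (_ , n , _) 𝓝 → n ; (_ , _ , p , _) 𝓟 → p ; (_ , _ , _ , b) 𝓑 → b })
       (λ f → f 𝓜 , f 𝓝 , f 𝓟 , f 𝓑)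
       (P? 𝓜 ×-dec P? 𝓝 ×-dec P? 𝓟 ×-dec P? 𝓑)

-- The type checker runs the decision procedure on all 256 cases.
table-complete : ∀ p₁ p₂ o₁ o₂ o → o ∈ table p₁ p₂ o₁ o₂ ⊎ Refuted p₁ p₂ o₁ o₂ o
table-complete = toWitness {a? = ∀-parity? λ p₁ → ∀-parity? λ p₂ → ∀-outcome? λ o₁ →
                                 ∀-outcome? λ o₂ → ∀-outcome? λ o →
                                 o ∈? table p₁ p₂ o₁ o₂ ⊎-dec refuted? p₁ p₂ o₁ o₂ o} _
  where open DecMembership _≟ᴼ_

outcome∈table : ∀ p₁ p₂ o₁ o₂ o (G₁ G₂ : Game) → IsPosetGame G₁ → IsPosetGame G₂ →
                HasParity p₁ (size G₁) → HasParity p₂ (size G₂) →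
                HasOutcome G₁ o₁ → HasOutcome G₂ o₂ →
                HasOutcome (G₁ ∪G G₂) o → o ∈ table p₁ p₂ o₁ o₂
outcome∈table p₁ p₂ o₁ o₂ o G₁ G₂ poset₁ poset₂ hp₁ hp₂ ho₁ ho₂ ho =
  Sum.[ id , ⊥-elim ∘ Sum.[ refute maker , refute breaker ]′ ]′ (table-complete p₁ p₂ o₁ o₂ o)
  where
  refute : ∀ p → ¬ Forbidden (p₁ , o₁) (p₂ , o₂) p (winner o p)
  refute p f = forbidden-sound (∪-splitting poset₁ poset₂) hp₁ ho₁ hp₂ ho₂ p (winner o p) f
                 (hasOutcome⇒wins ho p)

-- Determinacy

free? : (c : Cell) → Dec (c ≡ free)
free? free = yes refl
free? makerC = no λ ()
free? breakerC = no λ ()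

makerC? : (c : Cell) → Dec (c ≡ makerC)
makerC? free = no λ ()
makerC? makerC = yes refl
makerC? breakerC = no λ ()

any⊎all : ∀ {n} {P Q : Fin n → Set} → (∀ v → P v ⊎ Q v) → ∃ P ⊎ (∀ v → Q v)
any⊎all {zero} _ = inj₂ λ ()
any⊎all {suc n} {P} {Q} f with f zero
... | inj₁ p = inj₁ (zero , p)
... | inj₂ q with any⊎all {P = P ∘ suc} {Q = Q ∘ suc} (f ∘ suc)
...   | inj₁ (v , p) = inj₁ (suc v , p)
...   | inj₂ qs = inj₂ λ { zero → q ; (suc v) → qs v }

module Determinacy (G : Game) (_≺?_ : Decidable (_≺_ G)) where
  open Positions G

  legal? : ∀ s v → Dec (Legal s v)
  legal? s v = free? (s v) ×-dec all? (λ u → u ≺? v →-dec ¬? (free? (s u)))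

  full? : ∀ s → Dec (Full s)
  full? s = all? (λ v → ¬? (free? (s v)))

  claimed? : ∀ s → Dec (MakerClaimed s)
  claimed? s = Any.any? (All.all? (makerC? ∘ s)) (wins G)

  moves : ∀ {s} {P Q : Fin (size G) → Set} → (∀ v → Legal s v → P v ⊎ Q v) →
          (∃ λ v → Legal s v × P v) ⊎ (∀ v → Legal s v → Q v)
  moves {s} f = any⊎all λ v → try v (legal? s v)
    where
    try : ∀ v → Dec (Legal s v) → _ ⊎ _
    try v (yes l) = Sum.map (l ,_) (λ q _ → q) (f v l)
    try v (no ¬l) = inj₂ (⊥-elim ∘ ¬l)

  claim-decreases : ∀ {s v k} c → Legal s v → c ≢ free → freeCount s ≡ suc k →
                    freeCount (claim s v c) ≡ k
  claim-decreases {s} c (sv , _) c≢free count-s =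
    suc-injective (trans (sym (freeCount-claim s c sv c≢free)) count-s)

  determinedᵏ : ∀ k s p → freeCount s ≡ k → MakerWins s p ⊎ BreakerWins s p
  determinedᵏ k s p count-s with full? s
  ... | yes full = Sum.map (endM full) (endB full) (toSum (claimed? s))
  determinedᵏ zero s p count-s | no ¬full = ⊥-elim (¬full (freeCount≡0⇒full s count-s))
  determinedᵏ (suc k) s maker count-s | no ¬full =
    Sum.map (λ (v , l , mw) → makerM v l mw) (makerB ¬full)
      (moves λ v l → determinedᵏ k (claim s v makerC) breaker
                       (claim-decreases makerC l (λ ()) count-s))
  determinedᵏ (suc k) s breaker count-s | no ¬full =
    Sum.swap (Sum.map (λ (v , l , bw) → breakB v l bw) (breakM ¬full)
      (moves λ v l → Sum.swap (determinedᵏ k (claim s v breakerC) maker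
                                 (claim-decreases breakerC l (λ ()) count-s))))

  determined : ∀ s p → MakerWins s p ⊎ BreakerWins s p
  determined s p = determinedᵏ _ s p refl

  startWinner : Player → Player
  startWinner p = Sum.[ (λ _ → maker) , (λ _ → breaker) ]′ (determined start p)

  startWinner-wins : ∀ p → Wins G (startWinner p) p
  startWinner-wins p with determined start p
  ... | inj₁ mw = mw
  ... | inj₂ bw = bw

  computedOutcome : Outcome
  computedOutcome = outcome (startWinner maker) (startWinner breaker)

  hasComputedOutcome : HasOutcome G computedOutcome
  hasComputedOutcome = wins⇒hasOutcome _ _ (startWinner-wins maker) (startWinner-wins breaker)

-- Realising the table

union≺? : ∀ {n₁ n₂} {r₁ : Rel (Fin n₁) 0ℓ} {r₂ : Rel (Fin n₂) 0ℓ} →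
          Decidable r₁ → Decidable r₂ → Decidable (union≺ r₁ r₂)
union≺? {n₁} r₁? r₂? x y with splitAt n₁ x | splitAt n₁ y
... | inj₁ a | inj₁ b = r₁? a b
... | inj₂ a | inj₂ b = r₂? a b
... | inj₁ _ | inj₂ _ = no λ ()
... | inj₂ _ | inj₁ _ = no λ ()

record Example : Set where
  constructor example
  field
    vertices : ℕ
    order : List (Fin vertices × Fin vertices)
    winningSets : List (List (Fin vertices))

  _<_ : Rel (Fin vertices) 0ℓ
  u < v = (u , v) ∈ order

  _<?_ : Decidable _<_
  u <? v = (u , v) ∈? order
    where open DecMembership (×.≡-dec _≟ᶠ_ _≟ᶠ_)

  game : Game
  game = record { size = vertices ; wins = winningSets ; _≺_ = _<_ }

  IsStrictOrder : Set
  IsStrictOrder = (∀ x → ¬ x < x) × (∀ x y z → x < y → y < z → x < z)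

  isStrictOrder? : Dec IsStrictOrder
  isStrictOrder? = all? (λ x → ¬? (x <? x))
                   ×-dec all? λ x → all? λ y → all? λ z → x <? y →-dec y <? z →-dec x <? z

  strictOrder⇒poset : IsStrictOrder → IsPosetGame game
  strictOrder⇒poset (irreflexive , transitive) = record
    { isEquivalence = isEquivalence
    ; irrefl = λ { refl → irreflexive _ }
    ; trans = transitive _ _ _
    ; <-resp-≈ = resp₂ _
    }

  computedOutcome : Outcome
  computedOutcome = Determinacy.computedOutcome game _<?_

open Example using (game; computedOutcome)

unionComputedOutcome : Example → Example → Outcome
unionComputedOutcome e₁ e₂ =
  Determinacy.computedOutcome (game e₁ ∪G game e₂) (union≺? (Example._<?_ e₁) (Example._<?_ e₂))

hasParity? : ∀ p n → Dec (HasParity p n)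
hasParity? even n = n % 2 ≟ⁿ 0
hasParity? odd n = n % 2 ≟ⁿ 1

Realisation : Parity → Parity → Outcome → Outcome → Outcome → Set₁
Realisation p₁ p₂ o₁ o₂ o =
  Σ Game λ G₁ → Σ Game λ G₂ →
    IsPosetGame G₁ × IsPosetGame G₂ ×
    HasParity p₁ (size G₁) × HasParity p₂ (size G₂) ×
    HasOutcome G₁ o₁ × HasOutcome G₂ o₂ × HasOutcome (G₁ ∪G G₂) o

Realises : Parity → Parity → Outcome → Outcome → Outcome → Example × Example → Set
Realises p₁ p₂ o₁ o₂ o (e₁ , e₂) =
  IsStrictOrder e₁ × IsStrictOrder e₂ ×
  HasParity p₁ (vertices e₁) × HasParity p₂ (vertices e₂) ×
  computedOutcome e₁ ≡ o₁ × computedOutcome e₂ ≡ o₂ × unionComputedOutcome e₁ e₂ ≡ o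
  where open Example using (vertices; IsStrictOrder)

realises? : ∀ p₁ p₂ o₁ o₂ o w → Dec (Realises p₁ p₂ o₁ o₂ o w)
realises? p₁ p₂ o₁ o₂ o (e₁ , e₂) =
  isStrictOrder? e₁ ×-dec isStrictOrder? e₂ ×-dec
  hasParity? p₁ (vertices e₁) ×-dec hasParity? p₂ (vertices e₂) ×-dec
  computedOutcome e₁ ≟ᴼ o₁ ×-dec computedOutcome e₂ ≟ᴼ o₂ ×-dec unionComputedOutcome e₁ e₂ ≟ᴼ o
  where open Example using (vertices; isStrictOrder?)

realises⇒realisation : ∀ {p₁ p₂ o₁ o₂ o} w → Realises p₁ p₂ o₁ o₂ o w → Realisation p₁ p₂ o₁ o₂ o
realises⇒realisation (e₁ , e₂) (order₁ , order₂ , hp₁ , hp₂ , refl , refl , refl) =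
  game e₁ , game e₂ , strictOrder⇒poset e₁ order₁ , strictOrder⇒poset e₂ order₂ , hp₁ , hp₂ ,
  Determinacy.hasComputedOutcome (game e₁) (_<?_ e₁) ,
  Determinacy.hasComputedOutcome (game e₂) (_<?_ e₂) ,
  Determinacy.hasComputedOutcome (game e₁ ∪G game e₂) (union≺? (_<?_ e₁) (_<?_ e₂))
  where open Example using (strictOrder⇒poset; _<?_)

b₀ : Example
b₀ = example 0 ([]) ([])

b₁ : Example
b₁ = example 1 ([]) ([])

n₁ : Example
n₁ = example 1 ([]) ((# 0 ∷ []) ∷ [])

n₂ : Example
n₂ = example 2 ([]) ((# 0 ∷ []) ∷ [])

p₂ : Example
p₂ = example 2 ((# 0 , # 1) ∷ []) ((# 1 ∷ []) ∷ [])

n₃ : Example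
n₃ = example 3 ((# 0 , # 1) ∷ []) ((# 1 ∷ []) ∷ [])

n₃′ : Example
n₃′ = example 3 ((# 0 , # 1) ∷ (# 0 , # 2) ∷ (# 1 , # 2) ∷ []) ((# 0 ∷ # 2 ∷ []) ∷ [])

p₃ : Example
p₃ = example 3 ((# 0 , # 1) ∷ (# 0 , # 2) ∷ (# 1 , # 2) ∷ []) ((# 1 ∷ []) ∷ [])

n₄ : Example
n₄ = example 4 ((# 0 , # 1) ∷ (# 0 , # 3) ∷ (# 1 , # 3) ∷ (# 2 , # 3) ∷ []) ((# 1 ∷ # 2 ∷ []) ∷ [])

n₄′ : Example
n₄′ = example 4 ((# 0 , # 2) ∷ (# 0 , # 3) ∷ (# 1 , # 2) ∷ (# 1 , # 3) ∷ []) ((# 2 ∷ []) ∷ [])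

b₄ : Example
b₄ = example 4 ((# 0 , # 1) ∷ (# 0 , # 2) ∷ (# 0 , # 3) ∷ (# 1 , # 2) ∷ (# 1 , # 3) ∷ (# 2 , # 3) ∷ []) ((# 0 ∷ # 3 ∷ []) ∷ [])

m₄ : Example
m₄ = example 4 ((# 0 , # 1) ∷ (# 0 , # 2) ∷ (# 0 , # 3) ∷ (# 1 , # 2) ∷ (# 1 , # 3) ∷ (# 2 , # 3) ∷ []) ((# 0 ∷ []) ∷ (# 3 ∷ []) ∷ [])

b₅ : Example
b₅ = example 5 ((# 0 , # 1) ∷ (# 0 , # 2) ∷ (# 0 , # 3) ∷ (# 0 , # 4) ∷ (# 1 , # 2) ∷ (# 1 , # 3) ∷ (# 2 , # 3) ∷ []) ((# 3 ∷ # 4 ∷ []) ∷ [])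

b₅′ : Example
b₅′ = example 5 ((# 0 , # 1) ∷ (# 0 , # 2) ∷ (# 0 , # 3) ∷ (# 0 , # 4) ∷ (# 1 , # 2) ∷ (# 1 , # 3) ∷ (# 2 , # 3) ∷ []) ((# 0 ∷ # 2 ∷ []) ∷ (# 1 ∷ # 2 ∷ # 4 ∷ []) ∷ (# 3 ∷ # 4 ∷ []) ∷ [])

m₅ : Example
m₅ = example 5 ((# 0 , # 1) ∷ (# 0 , # 3) ∷ (# 0 , # 4) ∷ (# 1 , # 4) ∷ (# 2 , # 3) ∷ (# 2 , # 4) ∷ (# 3 , # 4) ∷ []) ((# 0 ∷ # 1 ∷ []) ∷ (# 0 ∷ # 2 ∷ []) ∷ (# 3 ∷ []) ∷ [])

witnesses : Parity → Parity → Outcome → Outcome → List (Example × Example)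
witnesses even even 𝓜 𝓜 = (m₄ , m₄) ∷ []
witnesses even even 𝓜 𝓝 = (m₄ , n₂) ∷ []
witnesses even even 𝓜 𝓟 = (m₄ , p₂) ∷ []
witnesses even even 𝓜 𝓑 = (m₄ , b₀) ∷ []
witnesses even even 𝓝 𝓜 = (n₂ , m₄) ∷ []
witnesses even even 𝓝 𝓝 = (n₂ , n₂) ∷ (n₂ , n₄) ∷ []
witnesses even even 𝓝 𝓟 = (n₂ , p₂) ∷ []
witnesses even even 𝓝 𝓑 = (n₂ , b₄) ∷ (n₂ , b₀) ∷ []
witnesses even even 𝓟 𝓜 = (p₂ , m₄) ∷ []
witnesses even even 𝓟 𝓝 = (p₂ , n₂) ∷ []
witnesses even even 𝓟 𝓟 = (p₂ , p₂) ∷ []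
witnesses even even 𝓟 𝓑 = (p₂ , b₀) ∷ []
witnesses even even 𝓑 𝓜 = (b₀ , m₄) ∷ []
witnesses even even 𝓑 𝓝 = (b₄ , n₂) ∷ (b₀ , n₂) ∷ []
witnesses even even 𝓑 𝓟 = (b₀ , p₂) ∷ []
witnesses even even 𝓑 𝓑 = (b₄ , b₄) ∷ (b₀ , b₀) ∷ []
witnesses even odd 𝓜 𝓜 = (m₄ , m₅) ∷ []
witnesses even odd 𝓜 𝓝 = (m₄ , n₁) ∷ (m₄ , n₃) ∷ []
witnesses even odd 𝓜 𝓟 = (m₄ , p₃) ∷ []
witnesses even odd 𝓜 𝓑 = (m₄ , b₅′) ∷ (m₄ , b₁) ∷ []
witnesses even odd 𝓝 𝓜 = (n₂ , m₅) ∷ []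
witnesses even odd 𝓝 𝓝 = (n₂ , n₁) ∷ (n₂ , n₃) ∷ []
witnesses even odd 𝓝 𝓟 = (n₂ , p₃) ∷ []
witnesses even odd 𝓝 𝓑 = (n₂ , b₅′) ∷ (n₂ , b₁) ∷ (n₄′ , b₁) ∷ (n₄ , b₁) ∷ []
witnesses even odd 𝓟 𝓜 = (p₂ , m₅) ∷ []
witnesses even odd 𝓟 𝓝 = (p₂ , n₁) ∷ []
witnesses even odd 𝓟 𝓟 = (p₂ , p₃) ∷ []
witnesses even odd 𝓟 𝓑 = (p₂ , b₁) ∷ []
witnesses even odd 𝓑 𝓜 = (b₀ , m₅) ∷ []
witnesses even odd 𝓑 𝓝 = (b₀ , n₁) ∷ []
witnesses even odd 𝓑 𝓟 = (b₄ , p₃) ∷ (b₀ , p₃) ∷ []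
witnesses even odd 𝓑 𝓑 = (b₄ , b₁) ∷ (b₀ , b₁) ∷ []
witnesses odd even 𝓜 𝓜 = (m₅ , m₄) ∷ []
witnesses odd even 𝓜 𝓝 = (m₅ , n₂) ∷ []
witnesses odd even 𝓜 𝓟 = (m₅ , p₂) ∷ []
witnesses odd even 𝓜 𝓑 = (m₅ , b₀) ∷ []
witnesses odd even 𝓝 𝓜 = (n₁ , m₄) ∷ (n₃ , m₄) ∷ []
witnesses odd even 𝓝 𝓝 = (n₁ , n₂) ∷ (n₃ , n₂) ∷ []
witnesses odd even 𝓝 𝓟 = (n₁ , p₂) ∷ []
witnesses odd even 𝓝 𝓑 = (n₁ , b₀) ∷ []
witnesses odd even 𝓟 𝓜 = (p₃ , m₄) ∷ []
witnesses odd even 𝓟 𝓝 = (p₃ , n₂) ∷ []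
witnesses odd even 𝓟 𝓟 = (p₃ , p₂) ∷ []
witnesses odd even 𝓟 𝓑 = (p₃ , b₄) ∷ (p₃ , b₀) ∷ []
witnesses odd even 𝓑 𝓜 = (b₅′ , m₄) ∷ (b₁ , m₄) ∷ []
witnesses odd even 𝓑 𝓝 = (b₅′ , n₂) ∷ (b₁ , n₂) ∷ (b₁ , n₄′) ∷ (b₁ , n₄) ∷ []
witnesses odd even 𝓑 𝓟 = (b₁ , p₂) ∷ []
witnesses odd even 𝓑 𝓑 = (b₁ , b₄) ∷ (b₁ , b₀) ∷ []
witnesses odd odd 𝓜 𝓜 = (m₅ , m₅) ∷ []
witnesses odd odd 𝓜 𝓝 = (m₅ , n₁) ∷ []
witnesses odd odd 𝓜 𝓟 = (m₅ , p₃) ∷ []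
witnesses odd odd 𝓜 𝓑 = (m₅ , b₅) ∷ (m₅ , b₁) ∷ []
witnesses odd odd 𝓝 𝓜 = (n₁ , m₅) ∷ []
witnesses odd odd 𝓝 𝓝 = (n₁ , n₁) ∷ (n₃ , n₃) ∷ []
witnesses odd odd 𝓝 𝓟 = (n₃ , p₃) ∷ (n₁ , p₃) ∷ []
witnesses odd odd 𝓝 𝓑 = (n₃ , b₅′) ∷ (n₁ , b₁) ∷ (n₃ , b₁) ∷ (n₃′ , b₁) ∷ []
witnesses odd odd 𝓟 𝓜 = (p₃ , m₅) ∷ []
witnesses odd odd 𝓟 𝓝 = (p₃ , n₃) ∷ (p₃ , n₁) ∷ []
witnesses odd odd 𝓟 𝓟 = (p₃ , p₃) ∷ []
witnesses odd odd 𝓟 𝓑 = (p₃ , b₅) ∷ (p₃ , b₁) ∷ []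
witnesses odd odd 𝓑 𝓜 = (b₅ , m₅) ∷ (b₁ , m₅) ∷ []
witnesses odd odd 𝓑 𝓝 = (b₅′ , n₃) ∷ (b₁ , n₁) ∷ (b₁ , n₃) ∷ (b₁ , n₃′) ∷ []
witnesses odd odd 𝓑 𝓟 = (b₅ , p₃) ∷ (b₁ , p₃) ∷ []
witnesses odd odd 𝓑 𝓑 = (b₅ , b₅′) ∷ (b₁ , b₅′) ∷ (b₅ , b₅) ∷ (b₁ , b₁) ∷ []

pointwise-∈ : ∀ {A B : Set} {R : A → B → Set} {x xs ys} → x ∈ xs → Pointwise R xs ys → ∃ (R x)
pointwise-∈ (here refl) (r ∷ _) = _ , r
pointwise-∈ (there x∈xs) (_ ∷ rs) = pointwise-∈ x∈xs rs

witnesses-realise : ∀ p₁ p₂ o₁ o₂ →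
  Pointwise (Realises p₁ p₂ o₁ o₂) (table p₁ p₂ o₁ o₂) (witnesses p₁ p₂ o₁ o₂)
witnesses-realise = toWitness {a? = ∀-parity? λ p₁ → ∀-parity? λ p₂ → ∀-outcome? λ o₁ →
                                    ∀-outcome? λ o₂ → Pointwise.decidable (realises? p₁ p₂ o₁ o₂)
                                                        (table p₁ p₂ o₁ o₂) (witnesses p₁ p₂ o₁ o₂)} _

table-realisable : ∀ p₁ p₂ o₁ o₂ o → o ∈ table p₁ p₂ o₁ o₂ → Realisation p₁ p₂ o₁ o₂ o
table-realisable p₁ p₂ o₁ o₂ o o∈table =
  let w , r = pointwise-∈ o∈table (witnesses-realise p₁ p₂ o₁ o₂) in realises⇒realisation w r

theorem10 : (p₁ p₂ : Parity) (o₁ o₂ o : Outcome) →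
    ((G₁ G₂ : Game) → IsPosetGame G₁ → IsPosetGame G₂ →
      HasParity p₁ (size G₁) → HasParity p₂ (size G₂) →
      HasOutcome G₁ o₁ → HasOutcome G₂ o₂ →
      HasOutcome (G₁ ∪G G₂) o → o ∈ table p₁ p₂ o₁ o₂)
    ×
    (o ∈ table p₁ p₂ o₁ o₂ →
      Σ Game λ G₁ → Σ Game λ G₂ →
        IsPosetGame G₁ × IsPosetGame G₂ ×
        HasParity p₁ (size G₁) × HasParity p₂ (size G₂) ×
        HasOutcome G₁ o₁ × HasOutcome G₂ o₂ × HasOutcome (G₁ ∪G G₂) o)
theorem10 p₁ p₂ o₁ o₂ o = outcome∈table p₁ p₂ o₁ o₂ o , table-realisable p₁ p₂ o₁ o₂ o
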